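{- For every generalized infinite composition $\tilde\alpha$, the leading monomial of $G_{\tilde\alpha}$ is $LM(G_{\tilde\alpha})=X^{\tilde\alpha}=x_1^{\tilde\alpha_1}x_2^{\tilde\alpha_2}\cdots$.
   Context: A standard composition is a finite sequence of positive integers; for a composition $\alpha=[\alpha_1,\ldots,\alpha_k]$ of $d$ let $D(\alpha)=\{\alpha_1,\ldots,\alpha_1+\cdots+\alpha_{k-1}\}$ and $F_\alpha(x_1,x_2,\ldots)=\sum x_{j_1}\cdots x_{j_d}$ over $j_1\le\cdots\le j_d$ with $j_i<j_{i+1}$ whenever $i\in D(\alpha)$. A generalized composition is a finite or infinite sequence of nonnegative integers with finite sum $d(\cdot)$; $\ell(\cdot)$ is the length of a finite one; juxtaposition denotes concatenation. Every infinite generalized composition can be written $\tilde\alpha=\tilde\nu\,0\,0\cdots$ with $\tilde\nu$ finite and either empty or with nonzero last part. The series $G_{\tilde\alpha}\in\mathbb{Q}[[x_1,x_2,\ldots]]$ are defined recursively on $\ell(\tilde\nu)$: if $\tilde\nu=\nu$ has no zero parts, $G_{\tilde\alpha}=F_\nu(x_1,x_2,\ldots)$ (so $G_{0\,0\cdots}=1$); otherwise write uniquely $\tilde\nu=\tilde\gamma\,0\,a\,\beta$ with $a>0$, $\beta$ a (possibly empty) standard composition and $\tilde\gamma$ a (possibly empty) generalized composition, put $k=\ell(\tilde\gamma)+1$ and define $G_{\tilde\alpha}=G_{\tilde\gamma\,a\,\beta\,0\,0\cdots}-x_k\,G_{\tilde\gamma\,(a-1)\,\beta\,0\,0\cdots}$.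 Monomial order: $X^{\tilde\alpha}\le_{lex}X^{\tilde\beta}$ iff $d(\tilde\alpha)>d(\tilde\beta)$, or $d(\tilde\alpha)=d(\tilde\beta)$ and the leftmost nonzero entry of $(\tilde\beta_1-\tilde\alpha_1,\tilde\beta_2-\tilde\alpha_2,\ldots)$ is positive. The leading monomial $LM(P)$ of a nonzero series $P$ is its $\le_{lex}$-largest monomial with nonzero coefficient (i.e. among monomials of smallest degree, the lexicographically largest). -}

module Defs where

open import Data.Nat using (ℕ; zero; suc; _+_; _∸_; _<_; _≡ᵇ_; _<ᵇ_; _≤ᵇ_)
open import Data.Bool using (Bool; true; false; _∧_; if_then_else_) renaming (_≟_ to _≟ᵇ_)
open import Data.List using (List; []; _∷_; _++_; map; concatMap; length; upTo; reverse; filter)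
open import Data.Bool.ListAction using (all; any)
open import Data.Nat.ListAction using (sum)
open import Data.Maybe using (Maybe; just; nothing)
open import Data.Product using (_×_; _,_; Σ; ∃)
open import Data.Sum using (_⊎_)
open import Data.Integer using () renaming (+_ to ℤ+_)
open import Data.Rational using (ℚ; 0ℚ; _-_; _/_)
open import Relation.Binary.PropositionalEquality using (_≡_)
open import Relation.Nullary using (¬_)

-- A (generalized) composition / exponent vector is a finite list of naturals;
-- an infinite generalized composition α̃ is represented by a list followed by
-- infinitely many zeros (so lists differing by trailing zeros denote the same object).

get : List ℕ → ℕ → ℕ
get []       _       = 0
get (x ∷ xs) zero    = x
get (x ∷ xs) (suc i) = get xs i

d : List ℕ → ℕ
d = sum

-- A formal power series in x₁, x₂, … over ℚ, given by its coefficient function: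
-- the monomial X^m = x₁^{m 0} x₂^{m 1} ⋯ is encoded by its exponent list m
-- (variable x_{i+1} has 0-based index i).
Series : Set
Series = List ℕ → ℚ

-- D(α) = {α₁, α₁+α₂, …, α₁+⋯+α_{k-1}}
descentSet : List ℕ → List ℕ
descentSet []            = []
descentSet (a ∷ [])      = []
descentSet (a ∷ b ∷ r)   = a ∷ map (λ x → a + x) (descentSet (b ∷ r))

seqs : ℕ → ℕ → List (List ℕ)
seqs zero    L = [] ∷ []
seqs (suc n) L = concatMap (λ j → map (j ∷_) (seqs n L)) (upTo L)

-- index sequence j₁ ≤ ⋯ ≤ j_d with j_i < j_{i+1} for i ∈ D  (position counter starts at 1)
admissible : List ℕ → ℕ → List ℕ → Bool
admissible D i (x ∷ y ∷ r) =
  (if any (i ≡ᵇ_) D then x <ᵇ y else x ≤ᵇ y) ∧ admissible D (suc i) (y ∷ r)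
admissible D i _ = true

countᵇ : ℕ → List ℕ → ℕ
countᵇ i []       = 0
countᵇ i (x ∷ xs) = if i ≡ᵇ x then suc (countᵇ i xs) else countᵇ i xs

-- x_{j₁}⋯x_{j_d} equals X^m (all j's are < length m, since other variables have exponent 0)
hasContent : List ℕ → List ℕ → Bool
hasContent m j = all (λ i → countᵇ i j ≡ᵇ get m i) (upTo (length m))

F : List ℕ → Series
F α m = (ℤ+ length (filter (λ j → (admissible (descentSet α) 1 j ∧ hasContent m j) ≟ᵇ true)
                       (seqs (d α) (length m)))) / 1

stripZ : List ℕ → List ℕ
stripZ l = reverse (dropZ (reverse l))
  where
  dropZ : List ℕ → List ℕ
  dropZ (zero ∷ r) = dropZ r
  dropZ r          = r

-- on a reversed list: first zero, giving (reversed part before it, part after it)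
findZ : List ℕ → Maybe (List ℕ × List ℕ)
findZ []          = nothing
findZ (zero ∷ r)  = just ([] , r)
findZ (suc n ∷ r) with findZ r
... | nothing      = nothing
... | just (p , q) = just (suc n ∷ p , q)

-- ν̃ = γ̃ 0 a β  with a > 0 and β without zeros  ↦  (γ̃ , a , β)
split : List ℕ → Maybe (List ℕ × ℕ × List ℕ)
split ν with findZ (reverse ν)
... | nothing             = nothing
... | just (p , q) with reverse p
...   | []       = nothing          -- impossible when ν has no trailing zeros
...   | (a ∷ β)  = just (reverse q , a , β)

-- x_{k+1} · P  (0-based variable index k)
decAt : ℕ → List ℕ → List ℕ
decAt _       []       = []
decAt zero    (x ∷ xs) = (x ∸ 1) ∷ xs
decAt (suc k) (x ∷ xs) = x ∷ decAt k xs

mulX : ℕ → Series → Series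
mulX k P m = if get m k ≡ᵇ 0 then 0ℚ else P (decAt k m)

-- recursion with fuel; each recursive call lowers d + length, so fuel
-- d(α) + length(α) + 1 always suffices
Gf : ℕ → List ℕ → Series
Gf zero    α = λ _ → 0ℚ
Gf (suc f) α with split (stripZ α)
... | nothing            = F (stripZ α)
... | just (γ , a , β)   = λ m →
        Gf f (γ ++ a ∷ β) m - mulX (length γ) (Gf f (γ ++ (a ∸ 1) ∷ β)) m
        -- k = ℓ(γ̃)+1 in 1-based indexing = length γ in 0-based indexing

G : List ℕ → Series
G α = Gf (suc (d α + length α)) α

_≤lex_ : List ℕ → List ℕ → Set
m ≤lex α =
  d α < d m
  ⊎ (d m ≡ d α ×
      ((∀ i → get m i ≡ get α i)
       ⊎ Σ ℕ (λ i → (∀ j → j < i → get m j ≡ get α j) × get m i < get α i)))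

_∈supp_ : List ℕ → Series → Set
m ∈supp P = ¬ (P m ≡ 0ℚ)

LeadingMonomial : Series → List ℕ → Set
LeadingMonomial P α = α ∈supp P × (∀ m → m ∈supp P → m ≤lex α)

-- G (a ∷ ρ) is triangular in x₁: every monomial has x₁-degree at most a, and the part of
-- x₁-degree exactly a is x₁^a · G ρ (x₂, x₃, …).  This is proved along the defining
-- recursion of G; the base cases are coefficient identities for F ν, whose coefficient at
-- X^m is 1 or 0 according as the sorted index sequence with content X^m is admissible.
-- Since G α is moreover homogeneous of degree d(α), induction on α shows that X^α is the
-- lex-largest monomial of G α, and that it occurs.

module Submission where

open import Defs
open import Data.Nat using (ℕ)
open import Data.List using (List)

open import Data.Nat using (zero; suc; _+_; _*_; _∸_; _≤_; _<_; z≤n; s≤s; _≡ᵇ_; _<ᵇ_; _≤ᵇ_)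
open import Data.Nat.Properties
open import Data.List using ([]; _∷_; _++_; _∷ʳ_; map; length; reverse; replicate; concatMap; upTo; filter; drop)
open import Data.List.Properties using (unfold-reverse; reverse-++; reverse-involutive; length-++; length-replicate; map-++; map-replicate; map-∘; upTo-∷ʳ; ++-assoc)
open import Data.List.Reverse using (Reverse; reverseView; []; _∶_∶ʳ_)
open import Data.List.Relation.Unary.All using (All; []; _∷_)
import Data.List.Relation.Unary.All as All
import Data.List.Relation.Unary.All.Properties as All
open import Data.List.Relation.Unary.Linked using (Linked; []; [-]; _∷_)
open import Data.List.Relation.Unary.Linked.Properties using (Linked⇒AllPairs)
open import Data.List.Relation.Unary.AllPairs using (AllPairs; []; _∷_)
import Data.List.Relation.Unary.AllPairs.Properties as AllPairs
open import Data.Nat.ListAction.Properties using (sum-++)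
open import Data.Maybe using (Maybe; just; nothing)
import Data.Maybe as Maybe
open import Data.Product using (_×_; _,_; ∃₂; proj₁; proj₂; map₁)
open import Data.Sum using (_⊎_; inj₁; inj₂)
open import Data.Empty using (⊥-elim)
open import Data.Bool using (Bool; true; false; if_then_else_; _∧_; _∨_) renaming (_≟_ to _≟ᵇ_)
open import Data.Bool.ListAction using (any)
open import Data.Bool.Properties using (∧-zeroʳ; ∧-identityʳ; T-≡)
open import Function.Bundles using (Equivalence)
open import Data.List.Membership.Propositional.Properties using (∈-upTo⁺)
open import Data.Integer using () renaming (+_ to ℤ+_)
open import Data.Rational using (0ℚ; 1ℚ; _-_; _/_)
import Data.Rational.Properties as ℚ
open import Relation.Binary.PropositionalEquality
open import Function.Base using (_$_)
open import Relation.Binary.Definitions using (tri<; tri≈; tri>)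
open import Relation.Nullary using (¬_; yes; no)

Composition : List ℕ → Set
Composition = All (0 <_)

All-reverse : ∀ {P : ℕ → Set} xs → All P xs → All P (reverse xs)
All-reverse []       []         = []
All-reverse (x ∷ xs) (px ∷ pxs) rewrite unfold-reverse x xs = All.++⁺ (All-reverse xs pxs) (px ∷ [])

_∷₀_ : ℕ → List ℕ → List ℕ
a     ∷₀ (x ∷ xs) = a ∷ x ∷ xs
zero  ∷₀ []       = []
suc a ∷₀ []       = suc a ∷ []

∷₀-++ : ∀ a γ x β → a ∷₀ (γ ++ x ∷ β) ≡ a ∷ γ ++ x ∷ β
∷₀-++ a []      x β = refl
∷₀-++ a (_ ∷ _) x β = refl

suc-∷₀ : ∀ a ν → suc a ∷₀ ν ≡ suc a ∷ ν
suc-∷₀ a []      = refl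
suc-∷₀ a (_ ∷ _) = refl

stripZ-∷ʳ-zero : ∀ l → stripZ (l ∷ʳ 0) ≡ stripZ l
stripZ-∷ʳ-zero l rewrite reverse-++ l (0 ∷ []) = refl

stripZ-∷ʳ-suc : ∀ l n → stripZ (l ∷ʳ suc n) ≡ l ∷ʳ suc n
stripZ-∷ʳ-suc l n
  rewrite reverse-++ l (suc n ∷ []) | unfold-reverse (suc n) (reverse l) | reverse-involutive l = refl

stripZ-∷ : ∀ a ρ → stripZ (a ∷ ρ) ≡ a ∷₀ stripZ ρ
stripZ-∷ a ρ = go ρ (reverseView ρ)
  where
  go : ∀ ρ → Reverse ρ → stripZ (a ∷ ρ) ≡ a ∷₀ stripZ ρ
  go _ [] = singleton a
    where
    singleton : ∀ a → stripZ (a ∷ []) ≡ a ∷₀ []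
    singleton zero    = refl
    singleton (suc _) = refl
  go _ (xs ∶ rxs ∶ʳ zero) = begin
    stripZ (a ∷ xs ∷ʳ 0)  ≡⟨ stripZ-∷ʳ-zero (a ∷ xs) ⟩
    stripZ (a ∷ xs)       ≡⟨ go xs rxs ⟩
    a ∷₀ stripZ xs        ≡⟨ cong (a ∷₀_) (stripZ-∷ʳ-zero xs) ⟨
    a ∷₀ stripZ (xs ∷ʳ 0) ∎
    where open ≡-Reasoning
  go _ (xs ∶ _ ∶ʳ suc n) = begin
    stripZ (a ∷ xs ∷ʳ suc n)  ≡⟨ stripZ-∷ʳ-suc (a ∷ xs) n ⟩
    a ∷ xs ∷ʳ suc n           ≡⟨ ∷₀-++ a xs (suc n) [] ⟨
    a ∷₀ (xs ∷ʳ suc n)        ≡⟨ cong (a ∷₀_) (stripZ-∷ʳ-suc xs n) ⟨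
    a ∷₀ stripZ (xs ∷ʳ suc n) ∎
    where open ≡-Reasoning

d-∷₀ : ∀ a ν → d (a ∷₀ ν) ≡ a + d ν
d-∷₀ a     (x ∷ ν) = refl
d-∷₀ zero  []      = refl
d-∷₀ (suc a) []    = refl

d-stripZ : ∀ l → d (stripZ l) ≡ d l
d-stripZ []      = refl
d-stripZ (a ∷ ρ) rewrite stripZ-∷ a ρ = trans (d-∷₀ a (stripZ ρ)) (cong (a +_) (d-stripZ ρ))

length-∷₀ : ∀ a ν → length (a ∷₀ ν) ≤ suc (length ν)
length-∷₀ a       (x ∷ ν) = ≤-refl
length-∷₀ zero    []      = z≤n
length-∷₀ (suc a) []      = ≤-refl

length-stripZ : ∀ l → length (stripZ l) ≤ length l
length-stripZ []      = z≤n
length-stripZ (a ∷ ρ) rewrite stripZ-∷ a ρ = ≤-trans (length-∷₀ a (stripZ ρ)) (s≤s (length-stripZ ρ))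

NoTrailingZero : List ℕ → Set
NoTrailingZero ν = ν ≡ [] ⊎ ∃₂ λ ν′ n → ν ≡ ν′ ∷ʳ suc n

∷₀-noTrailingZero : ∀ a ν → NoTrailingZero ν → NoTrailingZero (a ∷₀ ν)
∷₀-noTrailingZero zero    _ (inj₁ refl) = inj₁ refl
∷₀-noTrailingZero (suc a) _ (inj₁ refl) = inj₂ ([] , a , refl)
∷₀-noTrailingZero a _ (inj₂ (ν′ , n , refl)) = inj₂ (a ∷ ν′ , n , ∷₀-++ a ν′ (suc n) [])

stripZ-noTrailingZero : ∀ l → NoTrailingZero (stripZ l)
stripZ-noTrailingZero []      = inj₁ refl
stripZ-noTrailingZero (a ∷ ρ) rewrite stripZ-∷ a ρ = ∷₀-noTrailingZero a (stripZ ρ) (stripZ-noTrailingZero ρ)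

stripZ-composition : ∀ {ν} → Composition ν → stripZ ν ≡ ν
stripZ-composition {[]}    _ = refl
stripZ-composition {suc a ∷ ν} (_ ∷ pν) rewrite stripZ-∷ (suc a) ν | stripZ-composition pν = suc-∷₀ a ν

findZ-suc : ∀ n r → findZ (suc n ∷ r) ≡ Maybe.map (map₁ (suc n ∷_)) (findZ r)
findZ-suc n r with findZ r
... | nothing = refl
... | just _  = refl

findZ-composition : ∀ {xs} → Composition xs → findZ xs ≡ nothing
findZ-composition {[]}        []       = refl
findZ-composition {suc n ∷ r} (_ ∷ pr) rewrite findZ-suc n r | findZ-composition pr = refl

findZ-composition-++ : ∀ {p} q → Composition p → findZ (p ++ 0 ∷ q) ≡ just (p , q)
findZ-composition-++ {[]}        q []       = refl
findZ-composition-++ {suc n ∷ p} q (_ ∷ pp) rewrite findZ-suc n (p ++ 0 ∷ q) | findZ-composition-++ q pp = refl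

findZ-nothing : ∀ xs → findZ xs ≡ nothing → Composition xs
findZ-nothing []          _ = []
findZ-nothing (suc n ∷ r) e rewrite findZ-suc n r with findZ r in e′
... | nothing = s≤s z≤n ∷ findZ-nothing r e′

findZ-just : ∀ xs {p q} → findZ xs ≡ just (p , q) → xs ≡ p ++ 0 ∷ q × Composition p
findZ-just (zero ∷ r)  refl = refl , []
findZ-just (suc n ∷ r) e rewrite findZ-suc n r with findZ r in e′
findZ-just (suc n ∷ r) refl | just (p , q) =
  let r≡ , pp = findZ-just r e′ in cong (suc n ∷_) r≡ , s≤s z≤n ∷ pp

reverse-++-∷ : ∀ xs (y : ℕ) ys → reverse (xs ++ y ∷ ys) ≡ reverse ys ++ y ∷ reverse xs
reverse-++-∷ xs y ys = begin
  reverse (xs ++ y ∷ ys)             ≡⟨ reverse-++ xs (y ∷ ys) ⟩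
  reverse (y ∷ ys) ++ reverse xs     ≡⟨ cong (_++ reverse xs) (unfold-reverse y ys) ⟩
  (reverse ys ∷ʳ y) ++ reverse xs    ≡⟨ ++-assoc (reverse ys) (y ∷ []) (reverse xs) ⟩
  reverse ys ++ y ∷ reverse xs       ∎
  where open ≡-Reasoning

-- the body of split, with its with-abstractions turned into functions one can reason about
reassemble : List ℕ → List ℕ → Maybe (List ℕ × ℕ × List ℕ)
reassemble []      q = nothing
reassemble (a ∷ β) q = just (reverse q , a , β)

splitAtFirstZero : Maybe (List ℕ × List ℕ) → Maybe (List ℕ × ℕ × List ℕ)
splitAtFirstZero nothing        = nothing
splitAtFirstZero (just (p , q)) = reassemble (reverse p) q

split-findZ : ∀ ν → split ν ≡ splitAtFirstZero (findZ (reverse ν))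
split-findZ ν with findZ (reverse ν)
... | nothing = refl
... | just (p , q) with reverse p
...   | []    = refl
...   | a ∷ β = refl

split-composition : ∀ {ν} → Composition ν → split ν ≡ nothing
split-composition {ν} pν rewrite split-findZ ν | findZ-composition (All-reverse ν pν) = refl

split-++ : ∀ γ {b β} → Composition (b ∷ β) → split (γ ++ 0 ∷ b ∷ β) ≡ just (γ , b , β)
split-++ γ {b} {β} pbβ
  rewrite split-findZ (γ ++ 0 ∷ b ∷ β) | reverse-++-∷ γ 0 (b ∷ β)
        | findZ-composition-++ (reverse γ) (All-reverse (b ∷ β) pbβ)
        | reverse-involutive (b ∷ β) | reverse-involutive γ = refl

split-just : ∀ ν {γ b β} → split ν ≡ just (γ , b , β) → ν ≡ γ ++ 0 ∷ b ∷ β × Composition (b ∷ β)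
split-just ν e rewrite split-findZ ν with findZ (reverse ν) in e₁
... | just (p , q) with reverse p in e₂
split-just ν refl | just (p , q) | b ∷ β =
  let rν≡ , pp = findZ-just (reverse ν) e₁ in
  (begin
    ν                        ≡⟨ reverse-involutive ν ⟨
    reverse (reverse ν)      ≡⟨ cong reverse rν≡ ⟩
    reverse (p ++ 0 ∷ q)     ≡⟨ reverse-++-∷ p 0 q ⟩
    reverse q ++ 0 ∷ reverse p ≡⟨ cong (λ r → reverse q ++ 0 ∷ r) e₂ ⟩
    reverse q ++ 0 ∷ b ∷ β   ∎) ,
  subst Composition e₂ (All-reverse p pp)
  where open ≡-Reasoning

split-nothing : ∀ {ν} → NoTrailingZero ν → split ν ≡ nothing → Composition ν
split-nothing (inj₁ refl) _ = []
split-nothing (inj₂ (ν′ , n , refl)) e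
  rewrite split-findZ (ν′ ∷ʳ suc n) | reverse-++-∷ ν′ (suc n) [] | findZ-suc n (reverse ν′)
  with findZ (reverse ν′) in e′
... | nothing = All.++⁺ (subst Composition (reverse-involutive ν′) (All-reverse (reverse ν′) (findZ-nothing (reverse ν′) e′)))
                        (s≤s z≤n ∷ [])
... | just (p , q) rewrite unfold-reverse (suc n) p = ⊥-elim (reassemble-∷ʳ (reverse p) e)
  where
  reassemble-∷ʳ : ∀ xs → ¬ reassemble (xs ∷ʳ suc n) q ≡ nothing
  reassemble-∷ʳ []      ()
  reassemble-∷ʳ (_ ∷ _) ()

GfStep : ℕ → List ℕ → Maybe (List ℕ × ℕ × List ℕ) → Series
GfStep f α nothing             = F (stripZ α)
GfStep f α (just (γ , a , β)) m = Gf f (γ ++ a ∷ β) m - mulX (length γ) (Gf f (γ ++ (a ∸ 1) ∷ β)) m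

Gf-suc : ∀ f α → Gf (suc f) α ≡ GfStep f α (split (stripZ α))
Gf-suc f α with split (stripZ α)
... | nothing = refl
... | just _  = refl

mulX-cong : ∀ k {P Q} → P ≗ Q → mulX k P ≗ mulX k Q
mulX-cong k P≗Q m = cong (if get m k ≡ᵇ 0 then 0ℚ else_) (P≗Q (decAt k m))

length-split : ∀ α {γ a β} → split (stripZ α) ≡ just (γ , a , β) → ∀ x → length (γ ++ x ∷ β) < length α
length-split α {γ} {a} {β} e x with split-just (stripZ α) e
... | α≡ , _ = begin-strict
  length (γ ++ x ∷ β)         ≡⟨ length-++ γ ⟩
  length γ + suc (length β)   <⟨ +-monoʳ-< (length γ) (n<1+n _) ⟩
  length γ + length (0 ∷ a ∷ β) ≡⟨ length-++ γ ⟨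
  length (γ ++ 0 ∷ a ∷ β)     ≡⟨ cong length α≡ ⟨
  length (stripZ α)           ≤⟨ length-stripZ α ⟩
  length α                    ∎
  where open ≤-Reasoning

Gf-fuel : ∀ f f′ α → length α < f → length α < f′ → Gf f α ≗ Gf f′ α
Gf-fuel (suc f) (suc f′) α (s≤s l<f) (s≤s l<f′) m
  rewrite Gf-suc f α | Gf-suc f′ α with split (stripZ α) in e
... | nothing          = refl
... | just (γ , a , β) = cong₂ _-_ (IH a m) (mulX-cong (length γ) (IH (a ∸ 1)) m)
  where
  IH : ∀ x → Gf f (γ ++ x ∷ β) ≗ Gf f′ (γ ++ x ∷ β)
  IH x = Gf-fuel f f′ _ (≤-trans (length-split α e x) l<f) (≤-trans (length-split α e x) l<f′)

G≗Gf : ∀ f α → length α < f → G α ≗ Gf f α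
G≗Gf f α = Gf-fuel _ f α (s≤s (m≤n+m (length α) (d α)))

G-F : ∀ α → split (stripZ α) ≡ nothing → G α ≗ F (stripZ α)
G-F α e m rewrite Gf-suc (d α + length α) α | e = refl

G-recursion : ∀ α {γ a β} → split (stripZ α) ≡ just (γ , a , β) →
              ∀ m → G α m ≡ G (γ ++ a ∷ β) m - mulX (length γ) (G (γ ++ (a ∸ 1) ∷ β)) m
G-recursion α {γ} e m rewrite Gf-suc (d α + length α) α | e =
  sym (cong₂ _-_ (G≗Gf _ _ (shorter _) m) (mulX-cong (length γ) (G≗Gf _ _ (shorter _)) m))
  where
  shorter : ∀ x → length (γ ++ x ∷ _) < d α + length α
  shorter x = <-≤-trans (length-split α e x) (m≤n+m (length α) (d α))

G-composition : ∀ α {ν} → stripZ α ≡ ν → Composition ν → G α ≗ F ν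
G-composition α refl pν = G-F α (split-composition pν)

G≗F : ∀ {ν} → Composition ν → G ν ≗ F ν
G≗F {ν} pν = G-composition ν (stripZ-composition pν) pν

∧-true : ∀ {a b} → a ∧ b ≡ true → a ≡ true × b ≡ true
∧-true {true} {true} _ = refl , refl

≡ᵇ-true⇒≡ : ∀ {x y} → (x ≡ᵇ y) ≡ true → x ≡ y
≡ᵇ-true⇒≡ {x} {y} e = ≡ᵇ⇒≡ x y (Equivalence.from T-≡ e)

≡ᵇ-refl : ∀ x → (x ≡ᵇ x) ≡ true
≡ᵇ-refl zero    = refl
≡ᵇ-refl (suc x) = ≡ᵇ-refl x

≢⇒≡ᵇ-false : ∀ {x y} → x ≢ y → (x ≡ᵇ y) ≡ false
≢⇒≡ᵇ-false {x} {y} x≢y with x ≡ᵇ y in e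
... | true  = ⊥-elim (x≢y (≡ᵇ-true⇒≡ e))
... | false = refl

countᵇ-++ : ∀ i xs ys → countᵇ i (xs ++ ys) ≡ countᵇ i xs + countᵇ i ys
countᵇ-++ i []       ys = refl
countᵇ-++ i (x ∷ xs) ys with i ≡ᵇ x
... | true  = cong suc (countᵇ-++ i xs ys)
... | false = countᵇ-++ i xs ys

countᵇ-absent : ∀ {i xs} → All (i ≢_) xs → countᵇ i xs ≡ 0
countᵇ-absent []           = refl
countᵇ-absent (i≢x ∷ i≢xs) rewrite ≢⇒≡ᵇ-false i≢x = countᵇ-absent i≢xs

countᵇ-replicate : ∀ c k → countᵇ k (replicate c k) ≡ c
countᵇ-replicate zero    k = refl
countᵇ-replicate (suc c) k rewrite ≡ᵇ-refl k = cong suc (countᵇ-replicate c k)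

countᵇ-head : ∀ x xs → 0 < countᵇ x (x ∷ xs)
countᵇ-head x xs rewrite ≡ᵇ-refl x = s≤s z≤n

countᵇ-∷-cancel : ∀ i x xs ys → countᵇ i (x ∷ xs) ≡ countᵇ i (x ∷ ys) → countᵇ i xs ≡ countᵇ i ys
countᵇ-∷-cancel i x xs ys e with i ≡ᵇ x
... | true  = suc-injective e
... | false = e

countᵇ-upTo : ∀ {x L} → x < L → countᵇ x (upTo L) ≡ 1
countᵇ-upTo {x} {suc L} x<1+L = begin
  countᵇ x (upTo (suc L))                 ≡⟨ cong (countᵇ x) (upTo-∷ʳ L) ⟨
  countᵇ x (upTo L ∷ʳ L)                  ≡⟨ countᵇ-++ x (upTo L) (L ∷ []) ⟩
  countᵇ x (upTo L) + countᵇ x (L ∷ [])   ≡⟨ last (m<1+n⇒m<n∨m≡n x<1+L) ⟩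
  1                                       ∎
  where
  open ≡-Reasoning
  last : x < L ⊎ x ≡ L → countᵇ x (upTo L) + countᵇ x (L ∷ []) ≡ 1
  last (inj₁ x<L)  rewrite countᵇ-upTo x<L | ≢⇒≡ᵇ-false (<⇒≢ x<L) = refl
  last (inj₂ refl) rewrite ≡ᵇ-refl x = cong (_+ 1) (countᵇ-absent (All.map >⇒≢ (All.all-upTo x)))

Sorted : List ℕ → Set
Sorted = AllPairs _≤_

sorted-head-≤ : ∀ {x xs y} → Sorted (x ∷ xs) → 0 < countᵇ y (x ∷ xs) → x ≤ y
sorted-head-≤ {x} {xs} {y} (x≤xs ∷ _) 0<c with <-cmp y x
... | tri< y<x _ _ = ⊥-elim (<-irrefl (sym (countᵇ-absent y∉)) 0<c)
  where
  y∉ : All (y ≢_) (x ∷ xs)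
  y∉ = <⇒≢ y<x ∷ All.map (λ x≤z → <⇒≢ (<-≤-trans y<x x≤z)) x≤xs
... | tri≈ _ refl _ = ≤-refl
... | tri> _ _ x<y = <⇒≤ x<y

sorted-unique : ∀ {xs ys} → Sorted xs → Sorted ys → (∀ i → countᵇ i xs ≡ countᵇ i ys) → xs ≡ ys
sorted-unique {[]}     {[]}     _ _ _ = refl
sorted-unique {[]}     {y ∷ ys} _ _ c = ⊥-elim (<-irrefl (c y) (countᵇ-head y ys))
sorted-unique {x ∷ xs} {[]}     _ _ c = ⊥-elim (<-irrefl (sym (c x)) (countᵇ-head x xs))
sorted-unique {x ∷ xs} {y ∷ ys} sxs@(_ ∷ sxs′) sys@(_ ∷ sys′) c with ≤-antisym
    (sorted-head-≤ sxs (subst (0 <_) (sym (c y)) (countᵇ-head y ys)))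
    (sorted-head-≤ sys (subst (0 <_) (c x) (countᵇ-head x xs)))
... | refl = cong (x ∷_) (sorted-unique sxs′ sys′ (λ i → countᵇ-∷-cancel i x xs ys (c i)))

admissible⇒sorted : ∀ D i j → admissible D i j ≡ true → Sorted j
admissible⇒sorted D i j e = Linked⇒AllPairs ≤-trans (linked D i j e)
  where
  step : ∀ b {x y} → (if b then x <ᵇ y else x ≤ᵇ y) ≡ true → x ≤ y
  step true  {x} {y} e = <⇒≤ (<ᵇ⇒< x y (Equivalence.from T-≡ e))
  step false {x} {y} e = ≤ᵇ⇒≤ x y (Equivalence.from T-≡ e)
  linked : ∀ D i j → admissible D i j ≡ true → Linked _≤_ j
  linked D i []          _ = []
  linked D i (x ∷ [])    _ = [-]
  linked D i (x ∷ y ∷ r) e =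
    let e₁ , e₂ = ∧-true {b = admissible D (suc i) (y ∷ r)} e in
    step (any (i ≡ᵇ_) D) e₁ ∷ linked D (suc i) (y ∷ r) e₂

sortedWordFrom : ℕ → List ℕ → List ℕ
sortedWordFrom k []      = []
sortedWordFrom k (e ∷ m) = replicate e k ++ sortedWordFrom (suc k) m

sortedWord : List ℕ → List ℕ
sortedWord = sortedWordFrom 0

length-sortedWordFrom : ∀ k m → length (sortedWordFrom k m) ≡ d m
length-sortedWordFrom k []      = refl
length-sortedWordFrom k (e ∷ m) rewrite length-++ (replicate e k) {sortedWordFrom (suc k) m}
  | length-replicate e {k} | length-sortedWordFrom (suc k) m = refl

sortedWordFrom-≥ : ∀ k m → All (k ≤_) (sortedWordFrom k m)
sortedWordFrom-≥ k []      = []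
sortedWordFrom-≥ k (e ∷ m) =
  All.++⁺ (All.replicate⁺ e ≤-refl) (All.map (≤-trans (n≤1+n k)) (sortedWordFrom-≥ (suc k) m))

sortedWordFrom-< : ∀ k m → All (_< k + length m) (sortedWordFrom k m)
sortedWordFrom-< k []      = []
sortedWordFrom-< k (e ∷ m) rewrite +-suc k (length m) =
  All.++⁺ (All.replicate⁺ e (s≤s (m≤m+n k (length m)))) (sortedWordFrom-< (suc k) m)

sorted-replicate : ∀ e k → Sorted (replicate e k)
sorted-replicate zero    k = []
sorted-replicate (suc e) k = All.replicate⁺ e ≤-refl ∷ sorted-replicate e k

sortedWordFrom-sorted : ∀ k m → Sorted (sortedWordFrom k m)
sortedWordFrom-sorted k []      = []
sortedWordFrom-sorted k (e ∷ m) =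
  AllPairs.++⁺ (sorted-replicate e k) (sortedWordFrom-sorted (suc k) m)
    (All.replicate⁺ e (All.map (≤-trans (n≤1+n k)) (sortedWordFrom-≥ (suc k) m)))

countᵇ-sortedWordFrom : ∀ k m i → countᵇ (k + i) (sortedWordFrom k m) ≡ get m i
countᵇ-sortedWordFrom k []      i = refl
countᵇ-sortedWordFrom k (e ∷ m) zero
  rewrite +-identityʳ k | countᵇ-++ k (replicate e k) (sortedWordFrom (suc k) m) | countᵇ-replicate e k
        | countᵇ-absent (All.map <⇒≢ (sortedWordFrom-≥ (suc k) m)) = +-identityʳ e
countᵇ-sortedWordFrom k (e ∷ m) (suc i)
  rewrite countᵇ-++ (k + suc i) (replicate e k) (sortedWordFrom (suc k) m)
        | countᵇ-absent (All.replicate⁺ e (m+1+n≢m k {i})) | +-suc k i = countᵇ-sortedWordFrom (suc k) m i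

sortedWordFrom-suc : ∀ k m → sortedWordFrom (suc k) m ≡ map suc (sortedWordFrom k m)
sortedWordFrom-suc k []      = refl
sortedWordFrom-suc k (e ∷ m) = sym (begin
  map suc (replicate e k ++ sortedWordFrom (suc k) m)         ≡⟨ map-++ suc (replicate e k) _ ⟩
  map suc (replicate e k) ++ map suc (sortedWordFrom (suc k) m) ≡⟨ cong₂ _++_ (map-replicate suc e k)
                                                                          (sym (sortedWordFrom-suc (suc k) m)) ⟩
  replicate e (suc k) ++ sortedWordFrom (suc (suc k)) m        ∎)
  where open ≡-Reasoning

get-≥-length : ∀ m {i} → length m ≤ i → get m i ≡ 0
get-≥-length []      _         = refl
get-≥-length (x ∷ m) (s≤s m≤i) = get-≥-length m m≤i

hasContent⇒countᵇ : ∀ m {j} → hasContent m j ≡ true → ∀ {i} → i < length m → countᵇ i j ≡ get m i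
hasContent⇒countᵇ m {j} e i<L =
  ≡ᵇ⇒≡ _ _ (All.lookup (All.all⁺ (λ i → countᵇ i j ≡ᵇ get m i) _ (Equivalence.from T-≡ e)) (∈-upTo⁺ i<L))

hasContent-sortedWord : ∀ m → hasContent m (sortedWord m) ≡ true
hasContent-sortedWord m =
  Equivalence.to T-≡ (All.all⁻ (λ i → countᵇ i (sortedWord m) ≡ᵇ get m i)
    (All.universal (λ i → ≡⇒≡ᵇ _ _ (countᵇ-sortedWordFrom 0 m i)) (upTo (length m))))

content-unique : ∀ m {j} → Sorted j → All (_< length m) j → hasContent m j ≡ true → j ≡ sortedWord m
content-unique m {j} sj j<L e = sorted-unique sj (sortedWordFrom-sorted 0 m) counts
  where
  counts : ∀ i → countᵇ i j ≡ countᵇ i (sortedWord m)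
  counts i with i <? length m
  ... | yes i<L = trans (hasContent⇒countᵇ m {j} e i<L) (sym (countᵇ-sortedWordFrom 0 m i))
  ... | no  i≮L = begin
    countᵇ i j               ≡⟨ countᵇ-absent {i} {j} (All.map (λ x<L → >⇒≢ (<-≤-trans x<L (≮⇒≥ i≮L))) j<L) ⟩
    0                        ≡⟨ get-≥-length m (≮⇒≥ i≮L) ⟨
    get m i                  ≡⟨ countᵇ-sortedWordFrom 0 m i ⟨
    countᵇ i (sortedWord m)  ∎
    where open ≡-Reasoning

_==_ : List ℕ → List ℕ → Bool
[]       == []       = true
(x ∷ xs) == (y ∷ ys) = (x ≡ᵇ y) ∧ (xs == ys)
_        == _        = false

==⇒≡ : ∀ xs ys → xs == ys ≡ true → xs ≡ ys
==⇒≡ []       []       _ = refl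
==⇒≡ (x ∷ xs) (y ∷ ys) e = let e₁ , e₂ = ∧-true {x ≡ᵇ y} e in cong₂ _∷_ (≡ᵇ-true⇒≡ e₁) (==⇒≡ xs ys e₂)

==-refl : ∀ xs → xs == xs ≡ true
==-refl []       = refl
==-refl (x ∷ xs) rewrite ≡ᵇ-refl x = ==-refl xs

occurrences : List ℕ → List (List ℕ) → ℕ
occurrences s []       = 0
occurrences s (w ∷ ws) = if s == w then suc (occurrences s ws) else occurrences s ws

occurrences-++ : ∀ s ws vs → occurrences s (ws ++ vs) ≡ occurrences s ws + occurrences s vs
occurrences-++ s []       vs = refl
occurrences-++ s (w ∷ ws) vs with s == w
... | true  = cong suc (occurrences-++ s ws vs)
... | false = occurrences-++ s ws vs

-- seqs (suc n) L is prefixed (seqs n L) (upTo L) by definition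
prefixed : List (List ℕ) → List ℕ → List (List ℕ)
prefixed Y = concatMap (λ j → map (j ∷_) Y)

occurrences-[]-prefixed : ∀ Y js → occurrences [] (prefixed Y js) ≡ 0
occurrences-[]-prefixed Y []       = refl
occurrences-[]-prefixed Y (j ∷ js) rewrite occurrences-++ [] (map (j ∷_) Y) (prefixed Y js) =
  cong₂ _+_ (none Y) (occurrences-[]-prefixed Y js)
  where
  none : ∀ Y → occurrences [] (map (j ∷_) Y) ≡ 0
  none []      = refl
  none (_ ∷ Y) = none Y

occurrences-∷-map : ∀ x s j Y → occurrences (x ∷ s) (map (j ∷_) Y) ≡ (if x ≡ᵇ j then occurrences s Y else 0)
occurrences-∷-map x s j Y with x ≡ᵇ j in x≡j
... | true  = same Y
  where
  same : ∀ Y → occurrences (x ∷ s) (map (j ∷_) Y) ≡ occurrences s Y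
  same []      = refl
  same (y ∷ Y) rewrite x≡j | same Y = refl
... | false = none Y
  where
  none : ∀ Y → occurrences (x ∷ s) (map (j ∷_) Y) ≡ 0
  none []      = refl
  none (_ ∷ Y) rewrite x≡j = none Y

occurrences-∷-prefixed : ∀ x s Y js → occurrences (x ∷ s) (prefixed Y js) ≡ countᵇ x js * occurrences s Y
occurrences-∷-prefixed x s Y []       = refl
occurrences-∷-prefixed x s Y (j ∷ js)
  rewrite occurrences-++ (x ∷ s) (map (j ∷_) Y) (prefixed Y js) | occurrences-∷-map x s j Y
        | occurrences-∷-prefixed x s Y js with x ≡ᵇ j
... | true  = refl
... | false = refl

seqs-bounded : ∀ n L → All (All (_< L)) (seqs n L)
seqs-bounded zero    L = [] ∷ []
seqs-bounded (suc n) L = All.concat⁺ (All.map⁺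
  (All.map (λ j<L → All.map⁺ (All.map (j<L ∷_) (seqs-bounded n L))) (All.all-upTo L)))

occurrences-seqs : ∀ n L {s} → All (_< L) s → occurrences s (seqs n L) ≡ (if length s ≡ᵇ n then 1 else 0)
occurrences-seqs zero    L {[]}    _ = refl
occurrences-seqs zero    L {_ ∷ _} _ = refl
occurrences-seqs (suc n) L {[]}    _ = occurrences-[]-prefixed (seqs n L) (upTo L)
occurrences-seqs (suc n) L {x ∷ s} (x<L ∷ s<L)
  rewrite occurrences-∷-prefixed x s (seqs n L) (upTo L) | countᵇ-upTo x<L
        | +-identityʳ (occurrences s (seqs n L)) = occurrences-seqs n L s<L

length-filter-unique : ∀ (p : List ℕ → Bool) {Q : List ℕ → Set} s → (∀ {w} → Q w → p w ≡ true → w ≡ s) →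
                       ∀ {ws} → All Q ws →
                       length (filter (λ w → p w ≟ᵇ true) ws) ≡ (if p s then occurrences s ws else 0)
length-filter-unique p s uniq {[]} [] with p s
... | true  = refl
... | false = refl
length-filter-unique p s uniq {w ∷ ws} (qw ∷ qws) with p w in pw
... | true with uniq qw pw
...   | refl rewrite length-filter-unique p s uniq qws | pw | ==-refl s = refl
length-filter-unique p s uniq {w ∷ ws} (qw ∷ qws) | false
  rewrite length-filter-unique p s uniq qws with p s in ps
... | false = refl
... | true with s == w in sw
...   | false = refl
...   | true with ==⇒≡ s w sw
...     | refl with trans (sym pw) ps
...       | ()

inSuppF : List ℕ → List ℕ → Bool
inSuppF ν m = (d m ≡ᵇ d ν) ∧ admissible (descentSet ν) 1 (sortedWord m)

-- Admissible index sequences are sorted and only one sorted sequence has content X^m, so F ν is 0/1-valued.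
F-indicator : ∀ ν m → F ν m ≡ (if inSuppF ν m then 1ℚ else 0ℚ)
F-indicator ν m = trans (cong (λ n → (ℤ+ n) / 1) count) (toℚ (inSuppF ν m))
  where
  open ≡-Reasoning
  admissibleν : List ℕ → Bool
  admissibleν = admissible (descentSet ν) 1
  p : List ℕ → Bool
  p j = admissibleν j ∧ hasContent m j
  uniq : ∀ {j} → All (_< length m) j → p j ≡ true → j ≡ sortedWord m
  uniq {j} j<L e = content-unique m (admissible⇒sorted _ 1 j (proj₁ (∧-true e))) j<L (proj₂ (∧-true {admissibleν j} e))
  if-if : ∀ a b → (if a then (if b then 1 else 0) else 0) ≡ (if b ∧ a then 1 else 0)
  if-if true  true  = refl
  if-if true  false = refl
  if-if false true  = refl
  if-if false false = refl
  count : length (filter (λ j → p j ≟ᵇ true) (seqs (d ν) (length m))) ≡ (if inSuppF ν m then 1 else 0)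
  count = begin
    length (filter (λ j → p j ≟ᵇ true) (seqs (d ν) (length m)))
      ≡⟨ length-filter-unique p (sortedWord m) uniq (seqs-bounded (d ν) (length m)) ⟩
    (if p (sortedWord m) then occurrences (sortedWord m) (seqs (d ν) (length m)) else 0)
      ≡⟨ cong (λ n → if p (sortedWord m) then n else 0) (occurrences-seqs (d ν) (length m) (sortedWordFrom-< 0 m)) ⟩
    (if p (sortedWord m) then (if length (sortedWord m) ≡ᵇ d ν then 1 else 0) else 0)
      ≡⟨ cong₂ (λ a l → if a then (if l ≡ᵇ d ν then 1 else 0) else 0)
               (trans (cong (admissibleν (sortedWord m) ∧_) (hasContent-sortedWord m)) (∧-identityʳ _))
               (length-sortedWordFrom 0 m) ⟩
    (if admissibleν (sortedWord m) then (if d m ≡ᵇ d ν then 1 else 0) else 0)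
      ≡⟨ if-if (admissibleν (sortedWord m)) (d m ≡ᵇ d ν) ⟩
    (if inSuppF ν m then 1 else 0) ∎
  toℚ : ∀ c → (ℤ+ (if c then 1 else 0)) / 1 ≡ (if c then 1ℚ else 0ℚ)
  toℚ true  = refl
  toℚ false = refl

≡ᵇ-+ : ∀ k x y → (k + x ≡ᵇ k + y) ≡ (x ≡ᵇ y)
≡ᵇ-+ zero    x y = refl
≡ᵇ-+ (suc k) x y = ≡ᵇ-+ k x y

any-≡ᵇ-shift : ∀ k i D → any (k + i ≡ᵇ_) (map (k +_) D) ≡ any (i ≡ᵇ_) D
any-≡ᵇ-shift k i []      = refl
any-≡ᵇ-shift k i (x ∷ D) = cong₂ _∨_ (≡ᵇ-+ k i x) (any-≡ᵇ-shift k i D)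

any-≡ᵇ-below : ∀ {i} D → All (i <_) D → any (i ≡ᵇ_) D ≡ false
any-≡ᵇ-below []      []           = refl
any-≡ᵇ-below (x ∷ D) (i<x ∷ i<D) rewrite ≢⇒≡ᵇ-false (<⇒≢ i<x) = any-≡ᵇ-below D i<D

admissible-shift : ∀ k D i s → admissible (map (k +_) D) (k + i) s ≡ admissible D i s
admissible-shift k D i []          = refl
admissible-shift k D i (x ∷ [])    = refl
admissible-shift k D i (x ∷ y ∷ r) =
  cong₂ _∧_ (cong (λ b → if b then x <ᵇ y else x ≤ᵇ y) (any-≡ᵇ-shift k i D))
            (trans (cong (λ j → admissible (map (k +_) D) j (y ∷ r)) (sym (+-suc k i)))
                   (admissible-shift k D (suc i) (y ∷ r)))

admissible-map-suc : ∀ D i s → admissible D i (map suc s) ≡ admissible D i s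
admissible-map-suc D i []          = refl
admissible-map-suc D i (x ∷ [])    = refl
admissible-map-suc D i (x ∷ y ∷ r) = cong₂ _∧_ (step (any (i ≡ᵇ_) D)) (admissible-map-suc D (suc i) (y ∷ r))
  where
  <ᵇ-suc : ∀ x y → (x <ᵇ suc y) ≡ (x ≤ᵇ y)
  <ᵇ-suc zero    y = refl
  <ᵇ-suc (suc x) y = refl
  step : ∀ b → (if b then x <ᵇ y else x <ᵇ suc y) ≡ (if b then x <ᵇ y else x ≤ᵇ y)
  step true  = refl
  step false = <ᵇ-suc x y

admissible-∷-below : ∀ {x} D i s → x < i → admissible (x ∷ D) i s ≡ admissible D i s
admissible-∷-below D i []          _   = refl
admissible-∷-below D i (a ∷ [])    _   = refl
admissible-∷-below {x} D i (a ∷ b ∷ r) x<i =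
  cong₂ _∧_ (cong (λ c → if c ∨ any (i ≡ᵇ_) D then a <ᵇ b else a ≤ᵇ b) (≢⇒≡ᵇ-false (>⇒≢ x<i)))
            (admissible-∷-below D (suc i) (b ∷ r) (m<n⇒m<1+n x<i))

admissible-[] : ∀ i j s → admissible [] i s ≡ admissible [] j s
admissible-[] i j []          = refl
admissible-[] i j (x ∷ [])    = refl
admissible-[] i j (x ∷ y ∷ r) = cong (_ ∧_) (admissible-[] (suc i) (suc j) (y ∷ r))

admissible-zeros : ∀ D i n t → All (i + n ≤_) D →
                   admissible D i (replicate (suc n) 0 ++ t) ≡ admissible D (i + n) (0 ∷ t)
admissible-zeros D i zero    t _ rewrite +-identityʳ i = refl
admissible-zeros D i (suc n) t D≥
  rewrite any-≡ᵇ-below D (All.map (<-≤-trans (m<m+n i (s≤s z≤n))) D≥) | +-suc i n =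
  admissible-zeros D (suc i) n t D≥

admissible-zeros-descent : ∀ D i n t → any (i + n ≡ᵇ_) D ≡ true →
                           admissible D i (replicate (suc (suc n)) 0 ++ t) ≡ false
admissible-zeros-descent D i zero    t desc rewrite +-identityʳ i | desc = refl
admissible-zeros-descent D i (suc n) t desc =
  trans (cong ((if any (i ≡ᵇ_) D then 0 <ᵇ 0 else true) ∧_) (admissible-zeros-descent D (suc i) n t desc′)) (∧-zeroʳ _)
  where
  desc′ : any (suc i + n ≡ᵇ_) D ≡ true
  desc′ = trans (cong (λ j → any (j ≡ᵇ_) D) (sym (+-suc i n))) desc

descentSet-≥ : ∀ a ν → All (a ≤_) (descentSet (a ∷ ν))
descentSet-≥ a []      = []
descentSet-≥ a (b ∷ r) = ≤-refl ∷ All.map⁺ (All.universal (m≤m+n a) _)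

descentSet-suc : ∀ h ν → descentSet (suc (suc h) ∷ ν) ≡ map suc (descentSet (suc h ∷ ν))
descentSet-suc h []      = refl
descentSet-suc h (b ∷ r) = cong (suc (suc h) ∷_) (map-∘ (descentSet (b ∷ r)))

-- the descents of a ∷ ν beyond a are those of ν, shifted by a
admissible-descentSet-∷ : ∀ a ν s →
                          admissible (descentSet (suc a ∷ ν)) (suc (suc a)) s ≡ admissible (descentSet ν) 1 s
admissible-descentSet-∷ a []      s = admissible-[] _ _ s
admissible-descentSet-∷ a (b ∷ r) s = begin
  admissible (suc a ∷ map (suc a +_) D) (suc (suc a)) s  ≡⟨ admissible-∷-below _ (suc (suc a)) s ≤-refl ⟩
  admissible (map (suc a +_) D) (suc (suc a)) s          ≡⟨ cong (λ j → admissible (map (suc a +_) D) (suc j) s) (+-comm 1 a) ⟩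
  admissible (map (suc a +_) D) (suc a + 1) s            ≡⟨ admissible-shift (suc a) D 1 s ⟩
  admissible D 1 s                                       ∎
  where
  open ≡-Reasoning
  D = descentSet (b ∷ r)

replicate-+-++ : ∀ p q (x : ℕ) w → replicate (p + q) x ++ w ≡ replicate p x ++ replicate q x ++ w
replicate-+-++ zero    q x w = refl
replicate-+-++ (suc p) q x w = cong (x ∷_) (replicate-+-++ p q x w)

F-cong : ∀ ν m ν′ m′ → inSuppF ν m ≡ inSuppF ν′ m′ → F ν m ≡ F ν′ m′
F-cong ν m ν′ m′ e = trans (F-indicator ν m) (trans (cong (if_then 1ℚ else 0ℚ) e) (sym (F-indicator ν′ m′)))

F-zero : ∀ ν m → inSuppF ν m ≡ false → F ν m ≡ 0ℚ
F-zero ν m e = trans (F-indicator ν m) (cong (if_then 1ℚ else 0ℚ) e)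

F-off-degree : ∀ ν m → d m ≢ d ν → F ν m ≡ 0ℚ
F-off-degree ν m dm≢dν = F-zero ν m (cong (_∧ admissible (descentSet ν) 1 (sortedWord m)) (≢⇒≡ᵇ-false dm≢dν))

F-homogeneous : ∀ ν m → m ∈supp F ν → d m ≡ d ν
F-homogeneous ν m m∈F with d m ≟ d ν
... | yes dm≡dν = dm≡dν
... | no  dm≢dν = ⊥-elim (m∈F (F-off-degree ν m dm≢dν))

F-0∷ : ∀ ν m → F ν (0 ∷ m) ≡ F ν m
F-0∷ ν m = F-cong ν (0 ∷ m) ν m $ cong ((d m ≡ᵇ d ν) ∧_) $
  trans (cong (admissible (descentSet ν) 1) (sortedWordFrom-suc 0 m)) (admissible-map-suc (descentSet ν) 1 (sortedWord m))

F-suc∷-suc∷ : ∀ h ν e m → F (suc (suc h) ∷ ν) (suc e ∷ m) ≡ F (suc h ∷ ν) (e ∷ m)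
F-suc∷-suc∷ h ν e m = F-cong (suc (suc h) ∷ ν) (suc e ∷ m) (suc h ∷ ν) (e ∷ m) $ cong ((e + d m ≡ᵇ suc h + d ν) ∧_) $ begin
  admissible (descentSet (suc (suc h) ∷ ν)) 1 (0 ∷ w)  ≡⟨ cong (λ D → admissible D 1 (0 ∷ w)) (descentSet-suc h ν) ⟩
  admissible (map suc D) 1 (0 ∷ w)                     ≡⟨ skip w ⟩
  admissible (map suc D) 2 w                           ≡⟨ admissible-shift 1 D 1 w ⟩
  admissible D 1 w                                     ∎
  where
  open ≡-Reasoning
  D = descentSet (suc h ∷ ν)
  w = sortedWord (e ∷ m)
  1∉D : any (1 ≡ᵇ_) (map suc D) ≡ false
  1∉D = trans (any-≡ᵇ-shift 1 0 D) (any-≡ᵇ-below D (All.map (<-≤-trans (s≤s z≤n)) (descentSet-≥ (suc h) ν)))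
  skip : ∀ w → admissible (map suc D) 1 (0 ∷ w) ≡ admissible (map suc D) 2 w
  skip []      = refl
  skip (x ∷ w) = cong (λ b → (if b then 0 <ᵇ x else true) ∧ admissible (map suc D) 2 (x ∷ w)) 1∉D

F-head : ∀ a ν m → F (suc a ∷ ν) (suc a ∷ m) ≡ F ν m
F-head a ν m = F-cong (suc a ∷ ν) (suc a ∷ m) ν m $ cong₂ _∧_ (≡ᵇ-+ (suc a) (d m) (d ν)) $ begin
  admissible D 1 (replicate (suc a) 0 ++ sortedWordFrom 1 m)  ≡⟨ admissible-zeros D 1 a _ (descentSet-≥ (suc a) ν) ⟩
  admissible D (suc a) (0 ∷ sortedWordFrom 1 m)               ≡⟨ cong (λ w → admissible D (suc a) (0 ∷ w))
                                                                       (sortedWordFrom-suc 0 m) ⟩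
  admissible D (suc a) (0 ∷ map suc (sortedWord m))           ≡⟨ rest (sortedWord m) ⟩
  admissible (descentSet ν) 1 (sortedWord m)                  ∎
  where
  open ≡-Reasoning
  D = descentSet (suc a ∷ ν)
  0<suc : ∀ b y → (if b then 0 <ᵇ suc y else 0 ≤ᵇ suc y) ≡ true
  0<suc true  y = refl
  0<suc false y = refl
  rest : ∀ w → admissible D (suc a) (0 ∷ map suc w) ≡ admissible (descentSet ν) 1 w
  rest []      = refl
  rest (y ∷ w) = begin
    admissible D (suc a) (0 ∷ map suc (y ∷ w))    ≡⟨ cong (_∧ admissible D (suc (suc a)) (map suc (y ∷ w)))
                                                          (0<suc (any (suc a ≡ᵇ_) D) y) ⟩
    admissible D (suc (suc a)) (map suc (y ∷ w))  ≡⟨ admissible-map-suc D (suc (suc a)) (y ∷ w) ⟩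
    admissible D (suc (suc a)) (y ∷ w)            ≡⟨ admissible-descentSet-∷ a ν (y ∷ w) ⟩
    admissible (descentSet ν) 1 (y ∷ w)           ∎

-- Position a + 1 is a descent of suc a ∷ b ∷ r, but the sorted word repeats x₁ across it.
F-head-> : ∀ a ν e m → suc a < e → F (suc a ∷ ν) (e ∷ m) ≡ 0ℚ
F-head-> a []      e m a<e =
  F-off-degree (suc a ∷ []) (e ∷ m) (>⇒≢ (<-≤-trans (subst (_< e) (sym (+-identityʳ (suc a))) a<e) (m≤m+n e (d m))))
F-head-> a (b ∷ r) e m a<e with m≤n⇒∃[o]m+o≡n a<e
... | t , refl = F-zero (suc a ∷ b ∷ r) (suc (suc a) + t ∷ m) $
  trans (cong ((suc (suc a) + t + d m ≡ᵇ suc a + d (b ∷ r)) ∧_) not-admissible) (∧-zeroʳ _)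
  where
  open ≡-Reasoning
  D = descentSet (suc a ∷ b ∷ r)
  w = sortedWordFrom 1 m
  suc-a∈D : any (1 + a ≡ᵇ_) D ≡ true
  suc-a∈D = cong (_∨ any (suc a ≡ᵇ_) (map (suc a +_) (descentSet (b ∷ r)))) (≡ᵇ-refl a)
  not-admissible : admissible D 1 (replicate (suc (suc a) + t) 0 ++ w) ≡ false
  not-admissible = begin
    admissible D 1 (replicate (suc (suc a) + t) 0 ++ w)              ≡⟨ cong (admissible D 1)
                                                                             (replicate-+-++ (suc (suc a)) t 0 w) ⟩
    admissible D 1 (replicate (suc (suc a)) 0 ++ replicate t 0 ++ w) ≡⟨ admissible-zeros-descent D 1 a _ suc-a∈D ⟩
    false                                                            ∎

record Triangular (a : ℕ) (ρ : List ℕ) : Set where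
  field
    above    : ∀ m → a < get m 0 → G (a ∷ ρ) m ≡ 0ℚ
    diagonal : ∀ m → get m 0 ≡ a → G (a ∷ ρ) m ≡ G ρ (drop 1 m)

mulX-suc-above : ∀ k {a} P → (∀ m → a < get m 0 → P m ≡ 0ℚ) → ∀ m → a < get m 0 → mulX (suc k) P m ≡ 0ℚ
mulX-suc-above k P P-above (e ∷ m) a<e with get m k ≡ᵇ 0
... | true  = refl
... | false = P-above (e ∷ decAt k m) a<e

mulX-suc-diagonal : ∀ k {a} P Q → (∀ m → get m 0 ≡ a → P m ≡ Q (drop 1 m)) →
                    ∀ m → get m 0 ≡ a → mulX (suc k) P m ≡ mulX k Q (drop 1 m)
mulX-suc-diagonal k P Q P-diag []      _  = refl
mulX-suc-diagonal k P Q P-diag (e ∷ m) e≡a = cong (if get m k ≡ᵇ 0 then 0ℚ else_) (P-diag (e ∷ decAt k m) e≡a)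

split-stripZ-∷ : ∀ a ρ {γ b β} → split (stripZ ρ) ≡ just (γ , b , β) →
                 split (stripZ (a ∷ ρ)) ≡ just (a ∷ γ , b , β)
split-stripZ-∷ a ρ {γ} {b} {β} e with split-just (stripZ ρ) e
... | ρ≡ , pbβ = begin
  split (stripZ (a ∷ ρ))           ≡⟨ cong split (stripZ-∷ a ρ) ⟩
  split (a ∷₀ stripZ ρ)            ≡⟨ cong (λ ν → split (a ∷₀ ν)) ρ≡ ⟩
  split (a ∷₀ (γ ++ 0 ∷ b ∷ β))    ≡⟨ cong split (∷₀-++ a γ 0 (b ∷ β)) ⟩
  split ((a ∷ γ) ++ 0 ∷ b ∷ β)     ≡⟨ split-++ (a ∷ γ) pbβ ⟩
  just (a ∷ γ , b , β)             ∎
  where open ≡-Reasoning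

triangular-step : ∀ {a ρ γ b β} → split (stripZ ρ) ≡ just (γ , b , β) →
                  Triangular a (γ ++ b ∷ β) → Triangular a (γ ++ (b ∸ 1) ∷ β) → Triangular a ρ
triangular-step {a} {ρ} {γ} {b} {β} e T₁ T₂ = record
  { above    = λ m a<m → trans (G-recursion (a ∷ ρ) eₐ m)
      (cong₂ _-_ (T₁.above m a<m) (mulX-suc-above (length γ) (G (a ∷ γ ++ (b ∸ 1) ∷ β)) T₂.above m a<m))
  ; diagonal = λ m m≡a → trans (G-recursion (a ∷ ρ) eₐ m)
      (trans (cong₂ _-_ (T₁.diagonal m m≡a)
                        (mulX-suc-diagonal (length γ) (G (a ∷ γ ++ (b ∸ 1) ∷ β)) (G (γ ++ (b ∸ 1) ∷ β)) T₂.diagonal m m≡a))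
             (sym (G-recursion ρ e (drop 1 m))))
  }
  where
  module T₁ = Triangular T₁
  module T₂ = Triangular T₂
  eₐ = split-stripZ-∷ a ρ e

triangular-suc : ∀ {a ρ ν} → stripZ ρ ≡ ν → Composition ν → Triangular (suc a) ρ
triangular-suc {a} {ρ} {ν} ρ≡ pν = record
  { above    = λ { (e ∷ m) a<e → trans (Gₐ (e ∷ m)) (F-head-> a ν e m a<e) }
  ; diagonal = λ { (_ ∷ m) refl → trans (Gₐ _) (trans (F-head a ν m) (sym (G-composition ρ ρ≡ pν m))) }
  }
  where
  Gₐ : G (suc a ∷ ρ) ≗ F (suc a ∷ ν)
  Gₐ = G-composition (suc a ∷ ρ) (trans (stripZ-∷ (suc a) ρ) (trans (cong (suc a ∷₀_) ρ≡) (suc-∷₀ a ν)))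
                     (s≤s z≤n ∷ pν)

triangular-zero-[] : ∀ {ρ} → stripZ ρ ≡ [] → Triangular 0 ρ
triangular-zero-[] {ρ} ρ≡ = record
  { above    = λ { (suc e ∷ m) _ → trans (G₀ _) (F-off-degree [] (suc e ∷ m) (λ ())) }
  ; diagonal = λ { [] _ → trans (G₀ []) (sym (Gρ []))
                 ; (_ ∷ m) refl → trans (G₀ _) (trans (F-0∷ [] m) (sym (Gρ m))) }
  }
  where
  Gρ : G ρ ≗ F []
  Gρ = G-composition ρ ρ≡ []
  G₀ : G (0 ∷ ρ) ≗ F []
  G₀ = G-composition (0 ∷ ρ) (trans (stripZ-∷ 0 ρ) (cong (0 ∷₀_) ρ≡)) []

-- G (0 ∷ x ∷ xs) = F (x ∷ xs) − x₁ · G ((x − 1) ∷ xs), and the two terms cancel whenever x₁ occurs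
triangular-zero-∷ : ∀ {ρ x xs} → stripZ ρ ≡ x ∷ xs → Composition (x ∷ xs) → Triangular 0 xs → Triangular 0 ρ
triangular-zero-∷ {ρ} {x} {xs} ρ≡ pν@(0<x ∷ pxs) T = record
  { above    = λ { (suc e ∷ m) _ → trans (G₀ _) (cancel x 0<x e m) }
  ; diagonal = diagonal
  }
  where
  module T = Triangular T
  Gρ : G ρ ≗ F (x ∷ xs)
  Gρ = G-composition ρ ρ≡ pν
  G₀ : ∀ m → G (0 ∷ ρ) m ≡ G (x ∷ xs) m - mulX 0 (G ((x ∸ 1) ∷ xs)) m
  G₀ = G-recursion (0 ∷ ρ) (trans (cong split (trans (stripZ-∷ 0 ρ) (cong (0 ∷₀_) ρ≡))) (split-++ [] pν))
  diagonal : ∀ m → get m 0 ≡ 0 → G (0 ∷ ρ) m ≡ G ρ (drop 1 m)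
  diagonal []        _    = trans (G₀ []) (trans (ℚ.+-identityʳ _) (trans (G≗F pν []) (sym (Gρ []))))
  diagonal (.0 ∷ m) refl = trans (G₀ (0 ∷ m)) (trans (ℚ.+-identityʳ _)
                             (trans (G≗F pν (0 ∷ m)) (trans (F-0∷ (x ∷ xs) m) (sym (Gρ m)))))
  cancel : ∀ x → 0 < x → ∀ e m → G (x ∷ xs) (suc e ∷ m) - G ((x ∸ 1) ∷ xs) (e ∷ m) ≡ 0ℚ
  cancel (suc (suc h)) _ e m = trans
    (cong₂ _-_ (trans (G≗F (s≤s z≤n ∷ pxs) (suc e ∷ m)) (F-suc∷-suc∷ h xs e m)) (G≗F (s≤s z≤n ∷ pxs) (e ∷ m)))
    (ℚ.+-inverseʳ (F (suc h ∷ xs) (e ∷ m)))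
  cancel 1 _ zero m = trans
    (cong₂ _-_ (trans (G≗F (s≤s z≤n ∷ pxs) (1 ∷ m)) (F-head 0 xs m)) (trans (T.diagonal (0 ∷ m) refl) (G≗F pxs m)))
    (ℚ.+-inverseʳ (F xs m))
  cancel 1 _ (suc e) m =
    cong₂ _-_ (trans (G≗F (s≤s z≤n ∷ pxs) (suc (suc e) ∷ m)) (F-head-> 0 xs (suc (suc e)) m (s≤s (s≤s z≤n))))
              (T.above (suc e ∷ m) (s≤s z≤n))

triangular : ∀ a ρ → Triangular a ρ
triangular a ρ = go (suc (length ρ)) a ρ ≤-refl
  where
  go : ∀ n a ρ → length ρ < n → Triangular a ρ
  go (suc n) a ρ (s≤s ρ≤n) with split (stripZ ρ) in e
  ... | just (γ , b , β) = triangular-step e (go n a _ (shorter b)) (go n a _ (shorter (b ∸ 1)))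
    where
    shorter : ∀ x → length (γ ++ x ∷ β) < n
    shorter x = <-≤-trans (length-split ρ e x) ρ≤n
  ... | nothing = composition a (stripZ ρ) refl (split-nothing (stripZ-noTrailingZero ρ) e)
    where
    composition : ∀ a ν → stripZ ρ ≡ ν → Composition ν → Triangular a ρ
    composition (suc a) ν        ρ≡ pν = triangular-suc ρ≡ pν
    composition zero    []       ρ≡ _  = triangular-zero-[] ρ≡
    composition zero    (x ∷ xs) ρ≡ pν = triangular-zero-∷ ρ≡ pν
      (go n 0 xs (≤-trans (≤-reflexive (cong length (sym ρ≡))) (≤-trans (length-stripZ ρ) ρ≤n)))

d-decAt : ∀ k m → (get m k ≡ᵇ 0) ≡ false → d m ≡ suc (d (decAt k m))
d-decAt zero    (suc x ∷ m) _ = refl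
d-decAt (suc k) (x ∷ m)     e = trans (cong (x +_) (d-decAt k m e)) (+-suc x _)
d-decAt zero    []          ()
d-decAt zero    (zero ∷ m)  ()
d-decAt (suc k) []          ()

mulX-supp : ∀ k P {m} → m ∈supp mulX k P → decAt k m ∈supp P × d m ≡ suc (d (decAt k m))
mulX-supp k P {m} m∈ with get m k ≡ᵇ 0 in e
... | true  = ⊥-elim (m∈ refl)
... | false = m∈ , d-decAt k m e

p-q≢0⇒p≢0⊎q≢0 : ∀ p q → ¬ p - q ≡ 0ℚ → ¬ p ≡ 0ℚ ⊎ ¬ q ≡ 0ℚ
p-q≢0⇒p≢0⊎q≢0 p q p-q≢0 with p ℚ.≟ 0ℚ | q ℚ.≟ 0ℚ
... | no p≢0   | _        = inj₁ p≢0
... | yes _    | no q≢0   = inj₂ q≢0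
... | yes refl | yes refl = ⊥-elim (p-q≢0 refl)

d-++-∷ : ∀ γ x β → d (γ ++ x ∷ β) ≡ d γ + (x + d β)
d-++-∷ γ x β = sum-++ γ (x ∷ β)

d-split : ∀ α {γ a β} → split (stripZ α) ≡ just (γ , a , β) →
          d (γ ++ a ∷ β) ≡ d α × suc (d (γ ++ (a ∸ 1) ∷ β)) ≡ d α
d-split α {γ} {a} {β} e with split-just (stripZ α) e
... | α≡ , 0<a ∷ _ = d-a , trans (d-pred a 0<a) d-a
  where
  d-a : d (γ ++ a ∷ β) ≡ d α
  d-a = begin
    d (γ ++ a ∷ β)          ≡⟨ d-++-∷ γ a β ⟩
    d γ + (0 + a + d β)     ≡⟨ d-++-∷ γ 0 (a ∷ β) ⟨
    d (γ ++ 0 ∷ a ∷ β)      ≡⟨ cong d α≡ ⟨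
    d (stripZ α)            ≡⟨ d-stripZ α ⟩
    d α                     ∎
    where open ≡-Reasoning
  d-pred : ∀ a → 0 < a → suc (d (γ ++ (a ∸ 1) ∷ β)) ≡ d (γ ++ a ∷ β)
  d-pred (suc a) _ rewrite d-++-∷ γ a β | d-++-∷ γ (suc a) β = sym (+-suc (d γ) (a + d β))

G-homogeneous : ∀ α m → m ∈supp G α → d m ≡ d α
G-homogeneous α = go (suc (length α)) α ≤-refl
  where
  go : ∀ n α → length α < n → ∀ m → m ∈supp G α → d m ≡ d α
  go (suc n) α (s≤s α≤n) m m∈ = bySplit (split (stripZ α)) refl
    where
    IH : ∀ {γ a β} → split (stripZ α) ≡ just (γ , a , β) →
         ∀ x m → m ∈supp G (γ ++ x ∷ β) → d m ≡ d (γ ++ x ∷ β)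
    IH {γ} {β = β} e x = go n (γ ++ x ∷ β) (<-≤-trans (length-split α e x) α≤n)
    bySplit : ∀ s → split (stripZ α) ≡ s → d m ≡ d α
    bySplit nothing e = trans (F-homogeneous (stripZ α) m (λ z → m∈ (trans (G-F α e m) z))) (d-stripZ α)
    bySplit (just (γ , a , β)) e
      with p-q≢0⇒p≢0⊎q≢0 (G (γ ++ a ∷ β) m) (mulX (length γ) (G (γ ++ (a ∸ 1) ∷ β)) m)
                          (λ z → m∈ (trans (G-recursion α e m) z))
    ... | inj₁ m∈₁ = trans (IH e a m m∈₁) (proj₁ (d-split α e))
    ... | inj₂ m∈₂ with mulX-supp (length γ) (G (γ ++ (a ∸ 1) ∷ β)) m∈₂
    ...   | m′∈ , dm≡ = trans dm≡ (trans (cong suc (IH e (a ∸ 1) _ m′∈)) (proj₂ (d-split α e)))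

get-drop : ∀ m i → get m (suc i) ≡ get (drop 1 m) i
get-drop []      i = refl
get-drop (_ ∷ _) i = refl

d-drop : ∀ m → d m ≡ get m 0 + d (drop 1 m)
d-drop []      = refl
d-drop (_ ∷ _) = refl

d≡0⇒get≡0 : ∀ m → d m ≡ 0 → ∀ i → get m i ≡ 0
d≡0⇒get≡0 []      _ i       = refl
d≡0⇒get≡0 (x ∷ m) e zero    = m+n≡0⇒m≡0 x e
d≡0⇒get≡0 (x ∷ m) e (suc i) = d≡0⇒get≡0 m (m+n≡0⇒n≡0 x e) i

≤lex-∷ : ∀ {a ρ} m → get m 0 ≡ a → d m ≡ d (a ∷ ρ) → drop 1 m ≤lex ρ → m ≤lex (a ∷ ρ)
≤lex-∷ {a} {ρ} m m₀≡a dm≡ (inj₁ ρ<m′) = ⊥-elim (<-irrefl (sym (+-cancelˡ-≡ a _ _ d-tail)) ρ<m′)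
  where
  d-tail : a + d (drop 1 m) ≡ a + d ρ
  d-tail = trans (cong (_+ d (drop 1 m)) (sym m₀≡a)) (trans (sym (d-drop m)) dm≡)
≤lex-∷ m m₀≡a dm≡ (inj₂ (_ , inj₁ same)) =
  inj₂ (dm≡ , inj₁ λ { zero → m₀≡a ; (suc i) → trans (get-drop m i) (same i) })
≤lex-∷ m m₀≡a dm≡ (inj₂ (_ , inj₂ (i , agree , smaller))) =
  inj₂ (dm≡ , inj₂ (suc i , (λ { zero _ → m₀≡a ; (suc j) (s≤s j<i) → trans (get-drop m j) (agree j j<i) }) ,
                     subst (_< _) (sym (get-drop m i)) smaller))

corollary3p4 : (α : List ℕ) → LeadingMonomial (G α) α
corollary3p4 [] = (λ ()) , λ m m∈ → let dm≡0 = G-homogeneous [] m m∈ in inj₂ (dm≡0 , inj₁ (d≡0⇒get≡0 m dm≡0))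
corollary3p4 (a ∷ ρ) with corollary3p4 ρ
... | ρ∈ , ρ-max = (λ z → ρ∈ (trans (sym (diagonal (a ∷ ρ) refl)) z)) , bound
  where
  open Triangular (triangular a ρ)
  bound : ∀ m → m ∈supp G (a ∷ ρ) → m ≤lex (a ∷ ρ)
  bound m m∈ with <-cmp (get m 0) a
  ... | tri< m₀<a _ _ = inj₂ (G-homogeneous (a ∷ ρ) m m∈ , inj₂ (0 , (λ _ ()) , m₀<a))
  ... | tri≈ _ m₀≡a _ = ≤lex-∷ m m₀≡a (G-homogeneous (a ∷ ρ) m m∈)
                                       (ρ-max (drop 1 m) (λ z → m∈ (trans (diagonal m m₀≡a) z)))
  ... | tri> _ _ a<m₀ = ⊥-elim (m∈ (above m a<m₀))
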